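{- Let $m\ge 3$ and $d\ge 2$ be integers, and for integers $k\ge1$, $n\ge 0$ set $B_k(n)=\binom{n+k-1}{k-1}$. Then $$B_{d+1}(2m-1)-(d+1)B_{d+1}(m-1)\ge d(d-1).$$ -}

module Defs where

open import Data.Nat using (ℕ; zero; suc; _+_; _∸_)
open import Data.Nat.Combinatorics using (_C_)

-- B k n = binom (n + k - 1) (k - 1), defined for k ≥ 1 and n ≥ 0.
-- Natural-number subtraction (∸) is harmless since the statement only
-- applies B with k = d + 1 ≥ 3 and n = 2m-1, m-1 with m ≥ 3.
B : ℕ → ℕ → ℕ
B k n = (n + k ∸ 1) C (k ∸ 1)

{-# OPTIONS --safe #-}
-- Put n = m - 1 and b = n + d, so that B_{d+1}(m-1) = C(b,d) and B_{d+1}(2m-1) = C(n+1+b, d).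
-- Keeping three terms of Vandermonde's convolution gives
--   C(n+1+b, d) ≥ C(b,d) + (n+1) C(b,d-1) + C(n+1,2) C(b,d-2).
-- The first two terms equal (d+1) C(b,d), since d C(b,d) = (n+1) C(b,d-1), and the third is at
-- least 2 C(d,d-2) = d(d-1) because n ≥ 2.
module Submission where

open import Defs
open import Data.Nat using (ℕ; zero; suc; _+_; _*_; _∸_; _≤_; _≤′_; ≤′-refl; ≤′-step; s≤s)
open import Data.Nat.Properties
open import Data.Nat.Combinatorics
  using (_C_; nC1≡n; nCk≡nC[n∸k]; nCk+nC[k+1]≡[n+1]C[k+1])
open import Data.Nat.Tactic.RingSolver using (solve-∀)
open import Relation.Binary.PropositionalEquality

C-pascal : ∀ n k → suc n C suc k ≡ n C k + n C suc k
C-pascal n k = sym (nCk+nC[k+1]≡[n+1]C[k+1] n k)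

C-suc-monoˡ : ∀ n k → n C k ≤ suc n C k
C-suc-monoˡ n zero    = ≤-refl
C-suc-monoˡ n (suc k) rewrite C-pascal n k = m≤n+m (n C suc k) (n C k)

C-monoˡ : ∀ {m n} k → m ≤ n → m C k ≤ n C k
C-monoˡ k m≤n = C-monoˡ′ (≤⇒≤′ m≤n)
  where
  C-monoˡ′ : ∀ {m n} → m ≤′ n → m C k ≤ n C k
  C-monoˡ′ ≤′-refl        = ≤-refl
  C-monoˡ′ (≤′-step m≤′n) = ≤-trans (C-monoˡ′ m≤′n) (C-suc-monoˡ _ k)

[k+1]*[n+1]C[k+1]≡[n+1]*nCk : ∀ n k → suc k * (suc n C suc k) ≡ suc n * (n C k)
[k+1]*[n+1]C[k+1]≡[n+1]*nCk zero    zero    = refl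
[k+1]*[n+1]C[k+1]≡[n+1]*nCk zero    (suc k) = *-zeroʳ (2 + k)
[k+1]*[n+1]C[k+1]≡[n+1]*nCk (suc n) zero    rewrite nC1≡n (suc (suc n)) = *-comm 1 (suc (suc n))
[k+1]*[n+1]C[k+1]≡[n+1]*nCk (suc n) (suc k) = begin
  (2 + k) * (suc (suc n) C (2 + k))
    ≡⟨ cong ((2 + k) *_) (C-pascal (suc n) (suc k)) ⟩
  (2 + k) * (suc n C suc k + suc n C (2 + k))
    ≡⟨ split (suc n C suc k) (suc n C (2 + k)) k ⟩
  suc k * (suc n C suc k) + suc n C suc k + (2 + k) * (suc n C (2 + k))
    ≡⟨ cong₂ (λ u v → u + suc n C suc k + v)
             ([k+1]*[n+1]C[k+1]≡[n+1]*nCk n k) ([k+1]*[n+1]C[k+1]≡[n+1]*nCk n (suc k)) ⟩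
  suc n * (n C k) + suc n C suc k + suc n * (n C suc k)
    ≡⟨ cong (λ u → suc n * (n C k) + u + suc n * (n C suc k)) (C-pascal n k) ⟩
  suc n * (n C k) + (n C k + n C suc k) + suc n * (n C suc k)
    ≡⟨ merge (suc n) (n C k) (n C suc k) ⟩
  (2 + n) * (n C k + n C suc k)
    ≡⟨ cong ((2 + n) *_) (C-pascal n k) ⟨
  (2 + n) * (suc n C suc k)
    ∎
  where
  open ≡-Reasoning
  split : ∀ x y k → (2 + k) * (x + y) ≡ suc k * x + x + (2 + k) * y
  split = solve-∀
  merge : ∀ m p q → m * p + (p + q) + m * q ≡ (1 + m) * (p + q)
  merge = solve-∀

[k+1]*[n+k+1]C[k+1]≡[n+1]*[n+k+1]Ck : ∀ n k →
  suc k * ((n + suc k) C suc k) ≡ suc n * ((n + suc k) C k)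
[k+1]*[n+k+1]C[k+1]≡[n+1]*[n+k+1]Ck n k = +-cancelˡ-≡ (suc k * X) _ _ (begin
  suc k * X + suc k * Y   ≡⟨ *-distribˡ-+ (suc k) X Y ⟨
  suc k * (X + Y)         ≡⟨ cong (suc k *_) (C-pascal N k) ⟨
  suc k * (suc N C suc k) ≡⟨ [k+1]*[n+1]C[k+1]≡[n+1]*nCk N k ⟩
  suc N * X               ≡⟨ regroup n k X ⟩
  suc k * X + suc n * X   ∎)
  where
  open ≡-Reasoning
  N = n + suc k
  X = N C k
  Y = N C suc k
  regroup : ∀ n k x → suc (n + suc k) * x ≡ suc k * x + suc n * x
  regroup = solve-∀

2*[n+1]C2≡[n+1]*n : ∀ n → 2 * (suc n C 2) ≡ suc n * n
2*[n+1]C2≡[n+1]*n n = trans ([k+1]*[n+1]C[k+1]≡[n+1]*nCk n 1) (cong (suc n *_) (nC1≡n n))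

C-vandermonde-two : ∀ a b k → b C suc k + a * (b C k) ≤ (a + b) C suc k
C-vandermonde-two zero    b k = ≤-reflexive (+-identityʳ (b C suc k))
C-vandermonde-two (suc a) b k = begin
  b C suc k + suc a * (b C k)       ≡⟨ shuffle (b C suc k) (b C k) a ⟩
  b C k + (b C suc k + a * (b C k)) ≤⟨ +-mono-≤ (C-monoˡ k (m≤n+m b a)) (C-vandermonde-two a b k) ⟩
  (a + b) C k + (a + b) C suc k     ≡⟨ C-pascal (a + b) k ⟨
  (suc a + b) C suc k               ∎
  where
  open ≤-Reasoning
  shuffle : ∀ x y a → x + suc a * y ≡ y + (x + a * y)
  shuffle = solve-∀

C-vandermonde-three : ∀ a b k →
  b C (2 + k) + a * (b C suc k) + (a C 2) * (b C k) ≤ (a + b) C (2 + k)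
C-vandermonde-three zero    b k = ≤-reflexive (trans (+-identityʳ _) (+-identityʳ _))
C-vandermonde-three (suc a) b k = begin
  b C (2 + k) + suc a * (b C suc k) + (suc a C 2) * (b C k)
    ≡⟨ cong (λ c → b C (2 + k) + suc a * (b C suc k) + c * (b C k))
            (trans (C-pascal a 1) (cong (_+ a C 2) (nC1≡n a))) ⟩
  b C (2 + k) + suc a * (b C suc k) + (a + a C 2) * (b C k)
    ≡⟨ shuffle (b C (2 + k)) (b C suc k) (b C k) a (a C 2) ⟩
  (b C suc k + a * (b C k)) + (b C (2 + k) + a * (b C suc k) + (a C 2) * (b C k))
    ≤⟨ +-mono-≤ (C-vandermonde-two a b k) (C-vandermonde-three a b k) ⟩
  (a + b) C suc k + (a + b) C (2 + k)
    ≡⟨ C-pascal (a + b) (suc k) ⟨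
  (suc a + b) C (2 + k)
    ∎
  where
  open ≤-Reasoning
  shuffle : ∀ x y z a w → x + suc a * y + (a + w) * z ≡ (y + a * z) + (x + a * y + w * z)
  shuffle = solve-∀

d[d∸1]+[d+1]*[n+d]Cd≤[1+n+[n+d]]Cd : ∀ n d → 2 ≤ n → 2 ≤ d →
  d * (d ∸ 1) + (d + 1) * ((n + d) C d) ≤ (suc n + (n + d)) C d
d[d∸1]+[d+1]*[n+d]Cd≤[1+n+[n+d]]Cd n d@(suc (suc e)) 2≤n 2≤d@(s≤s (s≤s _)) = begin
  d * suc e + (d + 1) * Y
    ≡⟨ cong (d * suc e +_) (peel d Y) ⟩
  d * suc e + (Y + d * Y)
    ≡⟨ cong (λ t → d * suc e + (Y + t)) ([k+1]*[n+k+1]C[k+1]≡[n+1]*[n+k+1]Ck n (suc e)) ⟩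
  d * suc e + (Y + suc n * ((n + d) C suc e))
    ≤⟨ +-monoˡ-≤ _ d[d∸1]≤C2*C ⟩
  (suc n C 2) * ((n + d) C e) + (Y + suc n * ((n + d) C suc e))
    ≡⟨ +-comm _ (Y + suc n * ((n + d) C suc e)) ⟩
  Y + suc n * ((n + d) C suc e) + (suc n C 2) * ((n + d) C e)
    ≤⟨ C-vandermonde-three (suc n) (n + d) e ⟩
  (suc n + (n + d)) C d
    ∎
  where
  open ≤-Reasoning
  Y = (n + d) C d
  peel : ∀ d y → (d + 1) * y ≡ y + d * y
  peel = solve-∀
  d[d∸1]≤C2*C : d * suc e ≤ (suc n C 2) * ((n + d) C e)
  d[d∸1]≤C2*C = begin
    d * suc e             ≡⟨ 2*[n+1]C2≡[n+1]*n (suc e) ⟨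
    2 * (d C 2)           ≡⟨ cong (2 *_) (nCk≡nC[n∸k] 2≤d) ⟩
    2 * (d C e)           ≤⟨ *-mono-≤ (≤-trans (n≤1+n 2) (C-monoˡ 2 (s≤s 2≤n)))
                                      (C-monoˡ e (m≤n+m d n)) ⟩
    (suc n C 2) * ((n + d) C e) ∎

B[d+1]≡C : ∀ d x → B (d + 1) x ≡ (x + d) C d
B[d+1]≡C d x rewrite +-comm d 1 | +-suc x d = refl

2[1+n]∸1+d≡1+n+[n+d] : ∀ n d → 2 * suc n ∸ 1 + d ≡ suc n + (n + d)
2[1+n]∸1+d≡1+n+[n+d] = unfolded
  where
  unfolded : ∀ n d → n + suc (n + 0) + d ≡ suc n + (n + d)
  unfolded = solve-∀

lemma3p7 : (m d : ℕ) → 3 ≤ m → 2 ≤ d →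
    d * (d ∸ 1) + (d + 1) * B (d + 1) (m ∸ 1) ≤ B (d + 1) (2 * m ∸ 1)
lemma3p7 (suc n) d (s≤s 2≤n) 2≤d
  rewrite B[d+1]≡C d n | B[d+1]≡C d (2 * suc n ∸ 1) | 2[1+n]∸1+d≡1+n+[n+d] n d =
  d[d∸1]+[d+1]*[n+d]Cd≤[1+n+[n+d]]Cd n d 2≤n 2≤d
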